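{- Let $1 \leq a \leq b$ be integers. If $b \geq 2a$ then $N(a,b;2) \geq 2b^2+5b-(2a-4)$. If $b < 2a$ then $N(a,b;2) \geq 3b^2-(2a-5)b-(2a-4)$. (Here an inequality $N(a,b;2) \geq M$ means that there is a 2-coloring of $[1,M-1]$ with no monochromatic $(a,b)$-triple; it holds trivially if $N(a,b;2)$ does not exist.)
   Context: $\mathbf{N}=\{1,2,3,\dots\}$ and $[1,n]=\{1,2,\dots,n\}$. For integers $1 \leq a \leq b$, an $(a,b)$-triple is a set of the form $\{x,ax+d,bx+2d\}$ with $x,d \in \mathbf{N}$. $N(a,b;r)$ is the least positive integer, if it exists, such that every $r$-coloring of $[1,N(a,b;r)]$ contains a monochromatic $(a,b)$-triple. -}

module Defs where

open import Data.Nat using (ℕ; _+_; _*_; _∸_; _≤_; _<_; _≥_)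
open import Data.Bool using (Bool)
open import Data.Product using (Σ; _×_; ∃-syntax)
open import Relation.Binary.PropositionalEquality using (_≡_)
open import Relation.Nullary using (¬_)

-- A 2-coloring; only its values on [1,n] are relevant.
Coloring : Set
Coloring = ℕ → Bool

MonoTriple : ℕ → ℕ → ℕ → Coloring → Set
MonoTriple a b n c =
  ∃[ x ] ∃[ d ] (1 ≤ x × 1 ≤ d × x ≤ n × a * x + d ≤ n × b * x + 2 * d ≤ n
    × c x ≡ c (a * x + d) × c x ≡ c (b * x + 2 * d))

NLowerBound2 : ℕ → ℕ → ℕ → Set
NLowerBound2 a b M = ∃[ c ] ¬ MonoTriple a b (M ∸ 1) c

-- 2b² + 5b − (2a − 4)  (nonnegative when a ≤ b, so truncated ∸ is exact)
bound₁ : ℕ → ℕ → ℕ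
bound₁ a b = (2 * (b * b) + 5 * b + 4) ∸ 2 * a

-- 3b² − (2a − 5)b − (2a − 4)  (nonnegative when a ≤ b)
bound₂ : ℕ → ℕ → ℕ
bound₂ a b = (3 * (b * b) + 5 * b + 4) ∸ (2 * a * b + 2 * a)

-- Color [1, t] and everything above t² red and the block (t, t²] blue, where t = b + 1.
-- A triple {x, ax+d, bx+2d} starting in the blue block overshoots it, since bx + 2d > t².
-- A red triple starting in [1, t] ends above t², so its middle term is above t² as
-- well (otherwise bx + 2d ≤ t(ax + d) ≤ t²); then bx + 2d = 2(ax + d) + (b − 2a)x,
-- with x ≥ 1 if b ≥ 2a and x ≤ t if b < 2a, gives the two bounds.  Red triples
-- starting above t² end at or beyond 2(t² + 1) + b.  For a = b = 1 this coloring fails;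
-- there i ↦ [i mod 4 ≥ 2] colors [1, 7] without monochromatic 3-term progressions,
-- which is verified by deciding MonoTriple.

module Submission where

open import Defs
open import Data.Nat using (ℕ; zero; suc; _+_; _*_; _∸_; _%_; _≤_; _<_; z≤n; s≤s; _≤?_; _<?_)
open import Data.Nat.Properties
open import Data.Bool.Properties using () renaming (_≟_ to _≟ᵇ_)
open import Data.Product using (_×_; _,_; ∃; proj₂)
open import Data.Sum using (_⊎_; inj₁; inj₂)
open import Function using (_∘_)
open import Relation.Nullary using (¬_; Dec; yes; no; does; contradiction)
open import Relation.Nullary.Decidable using (_×-dec_; map′; from-no; dec-true; dec-false)
open import Relation.Binary.PropositionalEquality
  using (_≡_; refl; sym; trans; cong; cong₂; subst; module ≡-Reasoning)
open import Data.Nat.Tactic.RingSolver using (solve-∀)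

suc[b]<b*x+2*d : ∀ b {x d} → 1 ≤ x → 1 ≤ d → suc b < b * x + 2 * d
suc[b]<b*x+2*d b {x} {d} 1≤x 1≤d = begin-strict
  suc b           <⟨ n<1+n (suc b) ⟩
  2 + b           ≡⟨ +-comm 2 b ⟩
  b + 2           ≡⟨ cong (_+ 2) (sym (*-identityʳ b)) ⟩
  b * 1 + 2 * 1   ≤⟨ +-mono-≤ (*-monoʳ-≤ b 1≤x) (*-monoʳ-≤ 2 1≤d) ⟩
  b * x + 2 * d   ∎
  where open ≤-Reasoning

suc[b]²<b*x+2*d : ∀ b {x d} → suc b < x → 1 ≤ d → suc b * suc b < b * x + 2 * d
suc[b]²<b*x+2*d b {x} {d} b+1<x 1≤d = begin-strict
  suc b * suc b         <⟨ n<1+n (suc b * suc b) ⟩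
  suc (suc b * suc b)   ≡⟨ square-identity b ⟩
  b * (2 + b) + 2 * 1   ≤⟨ +-mono-≤ (*-monoʳ-≤ b b+1<x) (*-monoʳ-≤ 2 1≤d) ⟩
  b * x + 2 * d         ∎
  where
  open ≤-Reasoning
  square-identity : ∀ b → suc (suc b * suc b) ≡ b * (2 + b) + 2 * 1
  square-identity = solve-∀

b*x+2*d≤suc[b]*[a*x+d] : ∀ {a} b {x d} → 1 ≤ a → 1 ≤ b → b * x + 2 * d ≤ suc b * (a * x + d)
b*x+2*d≤suc[b]*[a*x+d] {a} b {x} {d} 1≤a 1≤b = begin
  b * x + 2 * d                   ≤⟨ +-mono-≤ (*-mono-≤ (n≤1+n b) x≤a*x) (*-monoˡ-≤ d (s≤s 1≤b)) ⟩
  suc b * (a * x) + suc b * d     ≡⟨ *-distribˡ-+ (suc b) (a * x) d ⟨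
  suc b * (a * x + d)             ∎
  where
  open ≤-Reasoning
  x≤a*x : x ≤ a * x
  x≤a*x = subst (_≤ a * x) (*-identityˡ x) (*-monoˡ-≤ x 1≤a)

2*suc[T]+b≤b*x+2*d : ∀ {T} b {x d} → 2 ≤ b → T < x → 1 ≤ d → 2 * suc T + b ≤ b * x + 2 * d
2*suc[T]+b≤b*x+2*d {T} b@(suc (suc β)) {x} {d} (s≤s (s≤s z≤n)) T<x 1≤d = begin
  2 * suc T + b                   ≤⟨ m≤m+n (2 * suc T + b) (β * T) ⟩
  2 * suc T + b + β * T           ≡⟨ identity T β ⟩
  b * suc T + 2 * 1               ≤⟨ +-mono-≤ (*-monoʳ-≤ b T<x) (*-monoʳ-≤ 2 1≤d) ⟩
  b * x + 2 * d                   ∎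
  where
  open ≤-Reasoning
  identity : ∀ T β → 2 * suc T + (2 + β) + β * T ≡ (2 + β) * suc T + 2 * 1
  identity = solve-∀

2*suc[T]+e≤[2*a+e]*x+2*d : ∀ {T} a e {x d} → 1 ≤ x → T < a * x + d →
                           2 * suc T + e ≤ (2 * a + e) * x + 2 * d
2*suc[T]+e≤[2*a+e]*x+2*d {T} a e {x} {d} 1≤x T<y = begin
  2 * suc T + e             ≡⟨ cong (2 * suc T +_) (*-identityʳ e) ⟨
  2 * suc T + e * 1         ≤⟨ +-mono-≤ (*-monoʳ-≤ 2 T<y) (*-monoʳ-≤ e 1≤x) ⟩
  2 * (a * x + d) + e * x   ≡⟨ identity a e x d ⟩
  (2 * a + e) * x + 2 * d   ∎
  where
  open ≤-Reasoning
  identity : ∀ a e x d → 2 * (a * x + d) + e * x ≡ (2 * a + e) * x + 2 * d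
  identity = solve-∀

2*suc[T]∸e*t≤b*x+2*d : ∀ {T a} b e {t x d} → 2 * a ≡ b + e → x ≤ t → T < a * x + d →
                       2 * suc T ∸ e * t ≤ b * x + 2 * d
2*suc[T]∸e*t≤b*x+2*d {T} {a} b e {t} {x} {d} 2a≡b+e x≤t T<y =
  m≤n+o⇒m∸n≤o (2 * suc T) (e * t) (begin
    2 * suc T                   ≤⟨ *-monoʳ-≤ 2 T<y ⟩
    2 * (a * x + d)             ≡⟨ *-distribˡ-+ 2 (a * x) d ⟩
    2 * (a * x) + 2 * d         ≡⟨ cong (_+ 2 * d) (*-assoc 2 a x) ⟨
    2 * a * x + 2 * d           ≡⟨ cong (λ k → k * x + 2 * d) 2a≡b+e ⟩
    (b + e) * x + 2 * d         ≡⟨ identity b e x d ⟩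
    e * x + (b * x + 2 * d)     ≤⟨ +-monoˡ-≤ (b * x + 2 * d) (*-monoʳ-≤ e x≤t) ⟩
    e * t + (b * x + 2 * d)     ∎)
  where
  open ≤-Reasoning
  identity : ∀ b e x d → (b + e) * x + 2 * d ≡ e * x + (b * x + 2 * d)
  identity = solve-∀

m≤n∸1⇒m<n : ∀ {m n} → 1 ≤ m → m ≤ n ∸ 1 → m < n
m≤n∸1⇒m<n {n = zero}  (s≤s _) ()
m≤n∸1⇒m<n {n = suc _} _       m≤n = s≤s m≤n

Middle : ℕ → ℕ → Set
Middle t i = t < i × i ≤ t * t

middle? : ∀ t i → Dec (Middle t i)
middle? t i = t <? i ×-dec i ≤? t * t

blockColoring : ℕ → Coloring
blockColoring t i = does (middle? t i)

middle-respects-color : ∀ {t i j} → blockColoring t i ≡ blockColoring t j → Middle t i → Middle t j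
middle-respects-color {t} {i} {j} i~j m with middle? t j
... | yes m′ = m′
... | no ¬m′ = contradiction (trans (sym (dec-true (middle? t i) m))
                                     (trans i~j (dec-false (middle? t j) ¬m′))) λ ()

above-middle : ∀ {t i} → t < i → ¬ Middle t i → t * t < i
above-middle t<i ¬m = ≰⇒> λ i≤t² → ¬m (t<i , i≤t²)

monochromatic⇒far⊎near : ∀ {a b x d} → 1 ≤ a → 1 ≤ b → 1 ≤ x → 1 ≤ d →
  let t = suc b ; c = blockColoring t in
  c x ≡ c (a * x + d) → c x ≡ c (b * x + 2 * d) →
  t * t < x ⊎ (x ≤ t × t * t < a * x + d)
monochromatic⇒far⊎near {a} {b} {x} {d} 1≤a 1≤b 1≤x 1≤d x~y x~z with x ≤? suc b
... | yes x≤t = inj₂ (x≤t , above-middle t<y (¬middle-x ∘ middle-respects-color (sym x~y)))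
  where
  ¬middle-x : ¬ Middle (suc b) x
  ¬middle-x (t<x , _) = <⇒≱ t<x x≤t
  z-far : suc b * suc b < b * x + 2 * d
  z-far = above-middle (suc[b]<b*x+2*d b 1≤x 1≤d) (¬middle-x ∘ middle-respects-color (sym x~z))
  t<y : suc b < a * x + d
  t<y = ≰⇒> λ y≤t → <⇒≱ z-far
          (≤-trans (b*x+2*d≤suc[b]*[a*x+d] b 1≤a 1≤b) (*-monoʳ-≤ (suc b) y≤t))
... | no x≰t with x ≤? suc b * suc b
...   | yes x≤t² = contradiction (proj₂ (middle-respects-color x~z (≰⇒> x≰t , x≤t²)))
                                 (<⇒≱ (suc[b]²<b*x+2*d b (≰⇒> x≰t) 1≤d))
...   | no x≰t² = inj₁ (≰⇒> x≰t²)

blockColoring-lowerBound : ∀ {a b M} → 1 ≤ a → 2 ≤ b →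
  let t = suc b in
  M ≤ 2 * suc (t * t) + b →
  (∀ {x d} → 1 ≤ x → 1 ≤ d → x ≤ t → t * t < a * x + d → M ≤ b * x + 2 * d) →
  NLowerBound2 a b M
blockColoring-lowerBound {a} {b} {M} 1≤a 2≤b M≤far M≤near = blockColoring (suc b) , no-triple
  where
  no-triple : ¬ MonoTriple a b (M ∸ 1) (blockColoring (suc b))
  no-triple (x , d , 1≤x , 1≤d , _ , _ , z≤M-1 , x~y , x~z) = <⇒≱ z<M M≤z
    where
    1≤b : 1 ≤ b
    1≤b = ≤-trans (s≤s z≤n) 2≤b
    z<M : b * x + 2 * d < M
    z<M = m≤n∸1⇒m<n (≤-trans (s≤s z≤n) (suc[b]<b*x+2*d b 1≤x 1≤d)) z≤M-1
    M≤z : M ≤ b * x + 2 * d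
    M≤z with monochromatic⇒far⊎near 1≤a 1≤b 1≤x 1≤d x~y x~z
    ... | inj₁ far          = ≤-trans M≤far (2*suc[T]+b≤b*x+2*d b 2≤b far 1≤d)
    ... | inj₂ (x≤t , near) = M≤near 1≤x 1≤d x≤t near

bound₁-≡ : ∀ a e → let b = 2 * a + e in bound₁ a b ≡ 2 * suc (suc b * suc b) + e
bound₁-≡ a e = trans (cong (_∸ 2 * a) (identity a e)) (m+n∸n≡m _ (2 * a))
  where
  identity : ∀ a e → let b = 2 * a + e in
             2 * (b * b) + 5 * b + 4 ≡ 2 * suc (suc b * suc b) + e + 2 * a
  identity = solve-∀

bound₂-≡ : ∀ a b e → 2 * a ≡ b + e → bound₂ a b ≡ 2 * suc (suc b * suc b) ∸ e * suc b
bound₂-≡ a b e 2a≡b+e = begin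
  (3 * (b * b) + 5 * b + 4) ∸ (2 * a * b + 2 * a)
    ≡⟨ cong₂ _∸_ (identity b) subtrahend ⟩
  (b * suc b + 2 * suc (suc b * suc b)) ∸ (b * suc b + e * suc b)
    ≡⟨ [m+n]∸[m+o]≡n∸o (b * suc b) _ _ ⟩
  2 * suc (suc b * suc b) ∸ e * suc b ∎
  where
  open ≡-Reasoning
  identity : ∀ b → 3 * (b * b) + 5 * b + 4 ≡ b * suc b + 2 * suc (suc b * suc b)
  identity = solve-∀
  subtrahend : 2 * a * b + 2 * a ≡ b * suc b + e * suc b
  subtrahend = begin
    2 * a * b + 2 * a   ≡⟨ +-comm (2 * a * b) (2 * a) ⟩
    2 * a + 2 * a * b   ≡⟨ *-suc (2 * a) b ⟨
    2 * a * suc b       ≡⟨ cong (_* suc b) 2a≡b+e ⟩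
    (b + e) * suc b     ≡⟨ *-distribʳ-+ (suc b) b e ⟩
    b * suc b + e * suc b ∎

lowerBound₁ : ∀ {a b} → 1 ≤ a → 2 ≤ b → 2 * a ≤ b → NLowerBound2 a b (bound₁ a b)
lowerBound₁ {a} 1≤a 2≤b 2a≤b with m≤n⇒∃[o]m+o≡n 2a≤b
... | e , refl = subst (NLowerBound2 a (2 * a + e)) (sym (bound₁-≡ a e))
  (blockColoring-lowerBound {a} {2 * a + e} 1≤a 2≤b (+-monoʳ-≤ _ (m≤n+m e (2 * a)))
     λ {x} {d} 1≤x _ _ near → 2*suc[T]+e≤[2*a+e]*x+2*d a e {x} {d} 1≤x near)

lowerBound₂ : ∀ {a b} → 1 ≤ a → 2 ≤ b → b < 2 * a → NLowerBound2 a b (bound₂ a b)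
lowerBound₂ {a} {b} 1≤a 2≤b b<2a with m≤n⇒∃[o]m+o≡n (<⇒≤ b<2a)
... | e , b+e≡2a = subst (NLowerBound2 a b) (sym (bound₂-≡ a b e (sym b+e≡2a)))
  (blockColoring-lowerBound {a} {b} 1≤a 2≤b
     (≤-trans (m∸n≤m (2 * suc (suc b * suc b)) (e * suc b)) (m≤m+n _ b))
     λ {x} {d} _ _ x≤t near →
       2*suc[T]∸e*t≤b*x+2*d {a = a} b e {x = x} {d} (sym b+e≡2a) x≤t near)

MonoTripleAt : ℕ → ℕ → ℕ → Coloring → ℕ → ℕ → Set
MonoTripleAt a b n c x d = 1 ≤ x × 1 ≤ d × x ≤ n × a * x + d ≤ n × b * x + 2 * d ≤ n
  × c x ≡ c (a * x + d) × c x ≡ c (b * x + 2 * d)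

monoTriple? : ∀ a b n c → Dec (MonoTriple a b n c)
monoTriple? a b n c = map′ forget bounded (anyUpTo? (λ x → anyUpTo? (triple? x) (suc n)) (suc n))
  where
  BoundedSearch : Set
  BoundedSearch = ∃ λ x → x < suc n × ∃ λ d → d < suc n × MonoTripleAt a b n c x d

  triple? : ∀ x d → Dec (MonoTripleAt a b n c x d)
  triple? x d = 1 ≤? x ×-dec 1 ≤? d ×-dec x ≤? n ×-dec a * x + d ≤? n ×-dec b * x + 2 * d ≤? n
                ×-dec c x ≟ᵇ c (a * x + d) ×-dec c x ≟ᵇ c (b * x + 2 * d)

  forget : BoundedSearch → MonoTriple a b n c
  forget (x , _ , d , _ , t) = x , d , t

  bounded : MonoTriple a b n c → BoundedSearch
  bounded (x , d , t@(_ , _ , x≤n , y≤n , _)) =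
    x , s≤s x≤n , d , s≤s (≤-trans (m≤n+m d (a * x)) y≤n) , t

mod4Coloring : Coloring
mod4Coloring i = does (2 ≤? i % 4)

mod4Coloring-avoids-AP₃ : ¬ MonoTriple 1 1 7 mod4Coloring
mod4Coloring-avoids-AP₃ = from-no (monoTriple? 1 1 7 mod4Coloring)

theorem2p4 : (a b : ℕ) → 1 ≤ a → a ≤ b →
    ((2 * a ≤ b → NLowerBound2 a b (bound₁ a b)) × (b < 2 * a → NLowerBound2 a b (bound₂ a b)))
theorem2p4 zero          _             ()  _
theorem2p4 (suc _)       zero          _   ()
theorem2p4 (suc (suc _)) 1             _   (s≤s ())
theorem2p4 1             1             _   _ =
  (λ { (s≤s ()) }) , λ _ → mod4Coloring , mod4Coloring-avoids-AP₃
theorem2p4 (suc _)       (suc (suc β)) 1≤a _ = lowerBound₁ 1≤a 2≤b , lowerBound₂ 1≤a 2≤b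
  where
  2≤b : 2 ≤ suc (suc β)
  2≤b = s≤s (s≤s z≤n)
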